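{- Let $m,n$ be positive integers and let $\mathcal{P}(m,n)\subseteq\mathbb{R}^m$ be the convex hull of all words of length $m$ with entries in $\{0,1,\ldots,n\}$ whose nonzero entries are pairwise distinct. Then the number of vertices of $\mathcal{P}(m,n)$ equals \[ \sum_{k=\max(m-n,0)}^{m}\frac{m!}{k!}. \]
   Context: Words of length $m$ are regarded as vectors in $\mathbb{R}^m$.
   Formalization: Points have coordinates in ℚ^m rather than $\mathbb{R}^m$, and the convex combinations defining $\mathcal{P}(m,n)$ and the midpoint test for vertices use only rational coefficients and rational points. -}

module Defs where

open import Data.Nat as ℕ using (ℕ; zero; suc; _∸_; _!)
open import Data.Nat.Properties using (_!≢0)
open import Data.Fin using (Fin)
open import Data.Vec using (Vec; []; _∷_; lookup; map; zipWith; replicate)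
open import Data.List as List using (List; []; _∷_; applyUpTo)
open import Data.Product using (_×_; _,_; ∃; ∃-syntax)
open import Data.Integer using (+_)
open import Data.Rational as ℚ using (ℚ; 0ℚ; 1ℚ; ½; _+_; _*_; _≤_)
open import Relation.Binary.PropositionalEquality using (_≡_; _≢_)
open import Data.List.Relation.Unary.All using (All)
open import Data.Nat.ListAction using (sum)

toℚ : ℕ → ℚ
toℚ k = (+ k) ℚ./ 1

IsWord : (m n : ℕ) → Vec ℕ m → Set
IsWord m n w =
  (∀ i → lookup w i ℕ.≤ n) ×
  (∀ (i j : Fin m) → i ≢ j → lookup w i ≢ 0 → lookup w i ≢ lookup w j)

-- Points of ℝ^m are represented by rational vectors (the polytope is rational).
Point : ℕ → Set
Point m = Vec ℚ m

combine : ∀ {m} → List (ℚ × Vec ℕ m) → Point m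
combine {m} [] = replicate m 0ℚ
combine ((c , w) ∷ rest) = zipWith _+_ (map (λ a → c * toℚ a) w) (combine rest)

coeffSum : ∀ {m} → List (ℚ × Vec ℕ m) → ℚ
coeffSum [] = 0ℚ
coeffSum ((c , _) ∷ rest) = c + coeffSum rest

InP : (m n : ℕ) → Point m → Set
InP m n x =
  ∃[ L ] (All (λ cw → (0ℚ ≤ Data.Product.proj₁ cw) × IsWord m n (Data.Product.proj₂ cw)) L
         × coeffSum L ≡ 1ℚ
         × combine L ≡ x)

IsVertex : (m n : ℕ) → Point m → Set
IsVertex m n x =
  InP m n x ×
  (∀ y z → InP m n y → InP m n z → x ≡ map (½ *_) (zipWith _+_ y z) → y ≡ z)

sumFromTo : ℕ → ℕ → (ℕ → ℕ) → ℕ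
sumFromTo a b f = sum (applyUpTo (λ i → f (a ℕ.+ i)) (suc b ∸ a))

factQuot : ℕ → ℕ → ℕ
factQuot m k = ℕ._/_ (m !) (k !) {{k !≢0}}

vertexCount : ℕ → ℕ → ℕ
vertexCount m n = sumFromTo (m ∸ n) m (factQuot m)

module Submission where

open import Defs
open import Data.Nat using (ℕ; suc; _≤_)
open import Data.List using (List; length)
open import Data.List.Membership.Propositional using (_∈_)
open import Data.List.Relation.Unary.Unique.Propositional using (Unique)
open import Data.Product using (Σ; _×_)
open import Function.Bundles using (_⇔_)
open import Relation.Binary.PropositionalEquality using (_≡_)

open import Data.Nat using (_<_)
open import Data.Fin using (Fin)
open import Data.Vec using (Vec; lookup)
open import Data.Product using (∃; _,_)
open import Relation.Binary.PropositionalEquality using (_≢_)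
import Function.Properties.Equivalence as ⇔

-- The vertices of P(m,n) are exactly the words whose nonzero values form a final segment
-- {n-j+1, ..., n} of {1, ..., n}.
--
-- Such a word w is a vertex because every representation of w as a convex combination of
-- words puts all its weight on w itself: going down from the largest value, a word v with
-- positive weight cannot exceed w at a position i, since vᵢ is a value that w takes at some
-- other position, where v already agrees with w.  Conversely, if a vertex x gives weight
-- c > 0 to a word w in some representation, then x is the midpoint of x + c(w - x) and
-- x - c(w - x), both again in P(m,n), so x = w; and a word missing a value u above one of
-- its nonzero values is the midpoint of the two words obtained by moving all its values in
-- (0, u) up, resp. down, by one.
--
-- For j ≤ min(m,n), the words with nonzero values exactly {n-j+1, ..., n} are the
-- arrangements of j distinct values into m slots; there are m!/(m-j)! of them.

NonzeroDistinct : ∀ {m} → Vec ℕ m → Set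
NonzeroDistinct {m} w = ∀ (i j : Fin m) → i ≢ j → lookup w i ≢ 0 → lookup w i ≢ lookup w j

UpClosed : ∀ {m} → ℕ → Vec ℕ m → Set
UpClosed n w = ∀ i u → lookup w i ≢ 0 → lookup w i < u → u ≤ n → ∃ λ p → lookup w p ≡ u

IsUpClosedWord : (m n : ℕ) → Vec ℕ m → Set
IsUpClosedWord m n w = IsWord m n w × UpClosed n w

module Vertices where
  open import Data.Nat as ℕ using (zero; _∸_)
  import Data.Nat.Properties as ℕ
  import Data.Nat.Coprimality as Coprime
  open import Data.Integer as ℤ using (+_; +≤+)
  import Data.Integer.Properties as ℤ
  open import Data.Rational as ℚ using (ℚ; mkℚ; 0ℚ; 1ℚ; ½; _+_; _*_; _-_; *≤*; nonNegative; positive)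
  open import Data.Rational.Properties
  open import Data.Rational.Solver using (module +-*-Solver)
  open import Algebra.Bundles using (CommutativeMonoid)
  open import Data.Fin.Properties using (any?)
  open import Data.Vec using (map; zipWith)
  open import Data.Vec.Properties using (lookup-map; lookup-zipWith; lookup-replicate; tabulate∘lookup; tabulate-cong)
  open import Data.List using ([]; _∷_; _++_)
  open import Data.List.Relation.Unary.All as All using (All; []; _∷_)
  import Data.List.Relation.Unary.All.Properties as All
  open import Data.List.Relation.Unary.Any using (here; there)
  open import Data.List.Membership.Propositional.Properties using (∈-++⁺ˡ; ∈-++⁺ʳ; ∈-map⁺; ∈-∃++)
  open import Data.Product using (proj₁; proj₂; map₁)
  open import Data.Empty using (⊥)
  open import Function.Bundles using (mk⇔)
  open import Relation.Binary.PropositionalEquality using (refl; sym; trans; cong; cong₂; subst; module ≡-Reasoning)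
  open import Relation.Binary.Definitions using (tri<; tri≈; tri>)
  open import Relation.Nullary using (yes; no; contradiction)
  open +-*-Solver

  lookup-extensionality : ∀ {A : Set} {k} {xs ys : Vec A k} → (∀ i → lookup xs i ≡ lookup ys i) → xs ≡ ys
  lookup-extensionality {xs = xs} {ys} eq =
    trans (sym (tabulate∘lookup xs)) (trans (tabulate-cong eq) (tabulate∘lookup ys))

  toℚ-mkℚ : ∀ k → toℚ k ≡ mkℚ (+ k) 0 (Coprime.sym (Coprime.1-coprimeTo k))
  toℚ-mkℚ k = normalize-coprime (Coprime.sym (Coprime.1-coprimeTo k))

  toℚ-injective : ∀ {a b} → toℚ a ≡ toℚ b → a ≡ b
  toℚ-injective {a} {b} eq = ℤ.+-injective (cong ℚ.numerator (trans (sym (toℚ-mkℚ a)) (trans eq (toℚ-mkℚ b))))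

  map-toℚ-injective : ∀ {k} {xs ys : Vec ℕ k} → map toℚ xs ≡ map toℚ ys → xs ≡ ys
  map-toℚ-injective {xs = xs} {ys} eq = lookup-extensionality λ i →
    toℚ-injective (trans (sym (lookup-map i toℚ xs)) (trans (cong (λ v → lookup v i) eq) (lookup-map i toℚ ys)))

  toℚ-mono-≤ : ∀ {a b} → a ℕ.≤ b → toℚ a ℚ.≤ toℚ b
  toℚ-mono-≤ {a} {b} a≤b rewrite toℚ-mkℚ a | toℚ-mkℚ b = *≤* (ℤ.*-monoʳ-≤-nonNeg (+ 1) (+≤+ a≤b))

  toℚ-nonNeg : ∀ a → 0ℚ ℚ.≤ toℚ a
  toℚ-nonNeg a = toℚ-mono-≤ {0} {a} ℕ.z≤n

  toℚ-+ : ∀ a b → toℚ (a ℕ.+ b) ≡ toℚ a + toℚ b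
  toℚ-+ a b rewrite toℚ-mkℚ a | toℚ-mkℚ b =
    sym (cong₂ (λ x y → (x ℤ.+ y) ℚ./ 1) (ℤ.*-identityʳ (+ a)) (ℤ.*-identityʳ (+ b)))

  *-nonNeg : ∀ {p q} → 0ℚ ℚ.≤ p → 0ℚ ℚ.≤ q → 0ℚ ℚ.≤ p * q
  *-nonNeg {p} {q} p≥0 q≥0 = nonNegative⁻¹ _ {{nonNeg*nonNeg⇒nonNeg p {{nonNegative p≥0}} q {{nonNegative q≥0}}}}

  *-pos : ∀ {p q} → 0ℚ ℚ.< p → 0ℚ ℚ.< q → 0ℚ ℚ.< p * q
  *-pos {p} {q} p>0 q>0 = positive⁻¹ _ {{pos*pos⇒pos p {{positive p>0}} q {{positive q>0}}}}

  *-monoˡ-≤-whenPos : ∀ {c p q} → 0ℚ ℚ.≤ c → (0ℚ ℚ.< c → p ℚ.≤ q) → c * p ℚ.≤ c * q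
  *-monoˡ-≤-whenPos {c} {p} {q} c≥0 p≤q with <-cmp 0ℚ c
  ... | tri< c>0 _ _ = *-monoˡ-≤-nonNeg c {{nonNegative c≥0}} (p≤q c>0)
  ... | tri≈ _ refl _ = ≤-reflexive (trans (*-zeroˡ p) (sym (*-zeroˡ q)))
  ... | tri> _ _ c<0 = contradiction (<-≤-trans c<0 c≥0) (<-irrefl refl)

  *-cancelˡ-≡-pos : ∀ {c p q} → 0ℚ ℚ.< c → c * p ≡ c * q → p ≡ q
  *-cancelˡ-≡-pos {c} c>0 eq = ≤-antisym (*-cancelˡ-≤-pos c {{positive c>0}} (≤-reflexive eq))
                                         (*-cancelˡ-≤-pos c {{positive c>0}} (≤-reflexive (sym eq)))

  +-mono-≤-≡ : ∀ {p p′ q q′} → p ℚ.≤ p′ → q ℚ.≤ q′ → p + q ≡ p′ + q′ → p ≡ p′ × q ≡ q′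
  +-mono-≤-≡ p≤p′ q≤q′ eq =
      ≤-antisym p≤p′ (≮⇒≥ λ p<p′ → <⇒≢ (+-mono-<-≤ p<p′ q≤q′) eq)
    , ≤-antisym q≤q′ (≮⇒≥ λ q<q′ → <⇒≢ (+-mono-≤-< p≤p′ q<q′) eq)

  midpoint-± : ∀ c a x → x ≡ ½ * ((x + c * (a - x)) + (x - c * (a - x)))
  midpoint-± = solve 3 (λ c a x → x := con ½ :* ((x :+ c :* (a :- x)) :+ (x :- c :* (a :- x)))) refl

  ±-equal⇒≡ : ∀ {c a x} → 0ℚ ℚ.< c → x + c * (a - x) ≡ x - c * (a - x) → x ≡ a
  ±-equal⇒≡ {c} {a} {x} c>0 eq = *-cancelˡ-≡-pos c>0 (begin
    c * x                                                ≡⟨ e₁ c a x ⟩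
    c * a - ½ * ((x + c * (a - x)) - (x - c * (a - x)))  ≡⟨ cong (λ t → c * a - ½ * (t - (x - c * (a - x)))) eq ⟩
    c * a - ½ * ((x - c * (a - x)) - (x - c * (a - x)))  ≡⟨ e₂ c a (x - c * (a - x)) ⟩
    c * a                                                ∎)
    where
    open ≡-Reasoning
    e₁ : ∀ c a x → c * x ≡ c * a - ½ * ((x + c * (a - x)) - (x - c * (a - x)))
    e₁ = solve 3 (λ c a x → c :* x := c :* a :- con ½ :* ((x :+ c :* (a :- x)) :- (x :- c :* (a :- x)))) refl
    e₂ : ∀ c a t → c * a - ½ * (t - t) ≡ c * a
    e₂ = solve 3 (λ c a t → c :* a :- con ½ :* (t :- t) := c :* a) refl

  Weights : Set → Set
  Weights A = List (ℚ × A)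

  module _ {A : Set} where
    weighted : (A → ℚ) → Weights A → ℚ
    weighted f [] = 0ℚ
    weighted f ((c , a) ∷ L) = c * f a + weighted f L

    scale : ℚ → Weights A → Weights A
    scale s = Data.List.map (map₁ (s *_))

    average : Weights A → Weights A → Weights A
    average L L′ = scale ½ L ++ scale ½ L′

    towards : ℚ → A → Weights A → Weights A
    towards c a L = (c , a) ∷ scale (1ℚ - c) L

    away : ℚ → A → Weights A → Weights A → Weights A
    away c a L₁ L₂ = (c * c , a) ∷ scale (1ℚ + c) (L₁ ++ L₂)

    AllNonNeg : Weights A → Set
    AllNonNeg = All (λ cw → 0ℚ ℚ.≤ proj₁ cw)

    OnSupport : (A → Set) → Weights A → Set
    OnSupport P L = ∀ {c a} → (c , a) ∈ L → 0ℚ ℚ.< c → P a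

    weighted-++ : ∀ f L L′ → weighted f (L ++ L′) ≡ weighted f L + weighted f L′
    weighted-++ f [] L′ = sym (+-identityˡ _)
    weighted-++ f ((c , a) ∷ L) L′ =
      trans (cong (_+_ (c * f a)) (weighted-++ f L L′)) (sym (+-assoc (c * f a) _ _))

    weighted-scale : ∀ f s L → weighted f (scale s L) ≡ s * weighted f L
    weighted-scale f s [] = sym (*-zeroʳ s)
    weighted-scale f s ((c , a) ∷ L) =
      trans (cong₂ _+_ (*-assoc s c (f a)) (weighted-scale f s L)) (sym (*-distribˡ-+ s _ _))

    weighted-extract : ∀ f L₁ c a L₂ → weighted f (L₁ ++ (c , a) ∷ L₂) ≡ c * f a + weighted f (L₁ ++ L₂)
    weighted-extract f [] c a L₂ = refl
    weighted-extract f ((d , b) ∷ L₁) c a L₂ =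
      trans (cong (_+_ (d * f b)) (weighted-extract f L₁ c a L₂)) (x∙yz≈y∙xz (d * f b) (c * f a) _)
      where
      open import Algebra.Properties.CommutativeSemigroup
        (CommutativeMonoid.commutativeSemigroup +-0-commutativeMonoid) using (x∙yz≈y∙xz)

    weighted-average : ∀ f L L′ → weighted f (average L L′) ≡ ½ * (weighted f L + weighted f L′)
    weighted-average f L L′ = begin
      weighted f (scale ½ L ++ scale ½ L′)              ≡⟨ weighted-++ f (scale ½ L) (scale ½ L′) ⟩
      weighted f (scale ½ L) + weighted f (scale ½ L′)  ≡⟨ cong₂ _+_ (weighted-scale f ½ L) (weighted-scale f ½ L′) ⟩
      ½ * weighted f L + ½ * weighted f L′              ≡⟨ *-distribˡ-+ ½ (weighted f L) (weighted f L′) ⟨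
      ½ * (weighted f L + weighted f L′)                ∎
      where open ≡-Reasoning

    weighted-towards : ∀ f c a L → let x = weighted f L in weighted f (towards c a L) ≡ x + c * (f a - x)
    weighted-towards f c a L = begin
      c * f a + weighted f (scale (1ℚ - c) L)  ≡⟨ cong (_+_ (c * f a)) (weighted-scale f (1ℚ - c) L) ⟩
      c * f a + (1ℚ - c) * weighted f L        ≡⟨ e c (f a) (weighted f L) ⟩
      weighted f L + c * (f a - weighted f L)  ∎
      where
      open ≡-Reasoning
      e : ∀ c b x → c * b + (1ℚ - c) * x ≡ x + c * (b - x)
      e = solve 3 (λ c b x → c :* b :+ (con 1ℚ :- c) :* x := x :+ c :* (b :- x)) refl

    weighted-away : ∀ f c a L₁ L₂ → let x = weighted f (L₁ ++ (c , a) ∷ L₂) in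
                    weighted f (away c a L₁ L₂) ≡ x - c * (f a - x)
    weighted-away f c a L₁ L₂ = begin
      c * c * f a + weighted f (scale (1ℚ + c) R)  ≡⟨ cong (_+_ (c * c * f a)) (weighted-scale f (1ℚ + c) R) ⟩
      c * c * f a + (1ℚ + c) * weighted f R        ≡⟨ e c (f a) (weighted f R) ⟩
      (c * f a + weighted f R) - c * (f a - (c * f a + weighted f R))
        ≡⟨ cong (λ x → x - c * (f a - x)) (weighted-extract f L₁ c a L₂) ⟨
      weighted f (L₁ ++ (c , a) ∷ L₂) - c * (f a - weighted f (L₁ ++ (c , a) ∷ L₂))
        ∎
      where
      open ≡-Reasoning
      R = L₁ ++ L₂
      e : ∀ c b r → c * c * b + (1ℚ + c) * r ≡ (c * b + r) - c * (b - (c * b + r))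
      e = solve 3 (λ c b r → c :* c :* b :+ (con 1ℚ :+ c) :* r := (c :* b :+ r) :- c :* (b :- (c :* b :+ r))) refl

    onSupport-average : ∀ {P L L′} → OnSupport P (average L L′) → OnSupport P L × OnSupport P L′
    onSupport-average supp =
        (λ mem c>0 → supp (∈-++⁺ˡ (∈-map⁺ (map₁ (½ *_)) mem)) (*-pos (positive⁻¹ ½) c>0))
      , (λ mem c>0 → supp (∈-++⁺ʳ _ (∈-map⁺ (map₁ (½ *_)) mem)) (*-pos (positive⁻¹ ½) c>0))

    weighted-mono : ∀ {f g} L → AllNonNeg L → OnSupport (λ a → f a ℚ.≤ g a) L → weighted f L ℚ.≤ weighted g L
    weighted-mono [] [] f≤g = ≤-refl
    weighted-mono ((c , a) ∷ L) (c≥0 ∷ nonNeg) f≤g =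
      +-mono-≤ (*-monoˡ-≤-whenPos c≥0 (f≤g (here refl))) (weighted-mono L nonNeg (λ mem → f≤g (there mem)))

    weighted-mono-≡ : ∀ {f g} L → AllNonNeg L → OnSupport (λ a → f a ℚ.≤ g a) L →
                      weighted f L ≡ weighted g L → OnSupport (λ a → f a ≡ g a) L
    weighted-mono-≡ ((c , a) ∷ L) (c≥0 ∷ nonNeg) f≤g eq
      with +-mono-≤-≡ (*-monoˡ-≤-whenPos c≥0 (f≤g (here refl))) (weighted-mono L nonNeg (λ mem → f≤g (there mem))) eq
    ... | head≡ , tail≡ = λ where
      (here refl) c>0 → *-cancelˡ-≡-pos c>0 head≡
      (there mem) → weighted-mono-≡ L nonNeg (λ mem → f≤g (there mem)) tail≡ mem

    weighted-cong : ∀ {f g} L → AllNonNeg L → OnSupport (λ a → f a ≡ g a) L → weighted f L ≡ weighted g L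
    weighted-cong L nonNeg f≡g = ≤-antisym (weighted-mono L nonNeg (λ mem c>0 → ≤-reflexive (f≡g mem c>0)))
                                           (weighted-mono L nonNeg (λ mem c>0 → ≤-reflexive (sym (f≡g mem c>0))))

  midpoint : ∀ {k} → Point k → Point k → Point k
  midpoint y z = map (½ *_) (zipWith _+_ y z)

  lookup-midpoint : ∀ {k} (y z : Point k) i → lookup (midpoint y z) i ≡ ½ * (lookup y i + lookup z i)
  lookup-midpoint y z i = trans (lookup-map i (½ *_) (zipWith _+_ y z)) (cong (½ *_) (lookup-zipWith _+_ i y z))

  module _ {m : ℕ} where
    coord : Fin m → Vec ℕ m → ℚ
    coord i v = toℚ (lookup v i)

    one : Vec ℕ m → ℚ
    one _ = 1ℚ

    lookup-combine : ∀ (L : Weights (Vec ℕ m)) i → lookup (combine L) i ≡ weighted (coord i) L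
    lookup-combine [] i = lookup-replicate i 0ℚ
    lookup-combine ((c , w) ∷ L) i =
      trans (lookup-zipWith _+_ i (map (λ a → c * toℚ a) w) (combine L))
            (cong₂ _+_ (lookup-map i (λ a → c * toℚ a) w) (lookup-combine L i))

    coeffSum-weighted : ∀ (L : Weights (Vec ℕ m)) → coeffSum L ≡ weighted one L
    coeffSum-weighted [] = refl
    coeffSum-weighted ((c , w) ∷ L) = cong₂ _+_ (sym (*-identityʳ c)) (coeffSum-weighted L)

    weighted-const : ∀ k (L : Weights (Vec ℕ m)) → weighted (λ _ → k) L ≡ k * coeffSum L
    weighted-const k [] = sym (*-zeroʳ k)
    weighted-const k ((c , w) ∷ L) =
      trans (cong₂ _+_ (*-comm c k) (weighted-const k L)) (sym (*-distribˡ-+ k c (coeffSum L)))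

  Valid : (m n : ℕ) → ℚ × Vec ℕ m → Set
  Valid m n (c , w) = 0ℚ ℚ.≤ c × IsWord m n w

  Represents : (m n : ℕ) → Weights (Vec ℕ m) → Point m → Set
  Represents m n L x = All (Valid m n) L × coeffSum L ≡ 1ℚ × combine L ≡ x

  UniquelyRepresented : (m n : ℕ) → Vec ℕ m → Set
  UniquelyRepresented m n w = ∀ L → Represents m n L (map toℚ w) → OnSupport (_≡ w) L

  module _ {m n : ℕ} where
    allNonNeg : ∀ {L} → All (Valid m n) L → AllNonNeg L
    allNonNeg = All.map proj₁

    coeffSum-nonNeg : ∀ {L} → All (Valid m n) L → 0ℚ ℚ.≤ coeffSum L
    coeffSum-nonNeg [] = ≤-refl
    coeffSum-nonNeg ((c≥0 , _) ∷ valid) = +-mono-≤ c≥0 (coeffSum-nonNeg valid)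

    scale-valid : ∀ {s L} → 0ℚ ℚ.≤ s → All (Valid m n) L → All (Valid m n) (scale s L)
    scale-valid s≥0 valid = All.map⁺ (All.map (λ (c≥0 , isWord) → *-nonNeg s≥0 c≥0 , isWord) valid)

    word-represents : ∀ {w} → IsWord m n w → Represents m n ((1ℚ , w) ∷ []) (map toℚ w)
    word-represents {w} isWord = (toℚ-nonNeg 1 , isWord) ∷ [] , +-identityʳ 1ℚ , lookup-extensionality λ i →
      trans (lookup-combine ((1ℚ , w) ∷ []) i)
            (trans (+-identityʳ _) (trans (*-identityˡ _) (sym (lookup-map i toℚ w))))

    represents-coord : ∀ {L x} → Represents m n L x → ∀ i → weighted (coord i) L ≡ lookup x i
    represents-coord {L} (_ , _ , refl) i = sym (lookup-combine L i)

    represents-const : ∀ {L x} → Represents m n L x → ∀ k → weighted (λ _ → k) L ≡ k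
    represents-const {L} (_ , total , _) k = trans (weighted-const k L) (trans (cong (k *_) total) (*-identityʳ k))

    represents-zero : ∀ {L x} → Represents m n L x → ∀ i → lookup x i ≡ 0ℚ → OnSupport (λ v → lookup v i ≡ 0) L
    represents-zero {L} r@(valid , _) i xᵢ≡0 mem c>0 =
      sym (toℚ-injective (weighted-mono-≡ L (allNonNeg valid) (λ {_} {v} _ _ → toℚ-nonNeg (lookup v i)) 0≡xᵢ mem c>0))
      where
      0≡xᵢ : weighted (λ _ → 0ℚ) L ≡ weighted (coord i) L
      0≡xᵢ = trans (represents-const r 0ℚ) (sym (trans (represents-coord r i) xᵢ≡0))

    represents-max : ∀ {L x} → Represents m n L x → ∀ i {a} → OnSupport (λ v → lookup v i ℕ.≤ a) L →
                     lookup x i ≡ toℚ a → OnSupport (λ v → lookup v i ≡ a) L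
    represents-max {L} r@(valid , _) i below xᵢ≡a mem c>0 =
      toℚ-injective (weighted-mono-≡ L (allNonNeg valid) (λ mem c>0 → toℚ-mono-≤ (below mem c>0))
                                     (trans (represents-coord r i) (trans xᵢ≡a (sym (represents-const r _)))) mem c>0)

    represents-onSupport : ∀ {L x w} → Represents m n L x → OnSupport (_≡ w) L → x ≡ map toℚ w
    represents-onSupport {L} {x} {w} r@(valid , _) supp = lookup-extensionality λ i → begin
      lookup x i                     ≡⟨ represents-coord r i ⟨
      weighted (coord i) L           ≡⟨ weighted-cong L (allNonNeg valid) (λ mem c>0 → cong (coord i) (supp mem c>0)) ⟩
      weighted (λ _ → coord i w) L   ≡⟨ represents-const r (coord i w) ⟩
      coord i w                      ≡⟨ lookup-map i toℚ w ⟨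
      lookup (map toℚ w) i           ∎
      where open ≡-Reasoning

    represents-midpoint : ∀ {Ly Lz y z} → Represents m n Ly y → Represents m n Lz z →
                          Represents m n (average Ly Lz) (midpoint y z)
    represents-midpoint {Ly} {Lz} {y} {z} rʸ@(validʸ , _) rᶻ@(validᶻ , _) =
        All.++⁺ (scale-valid ½≥0 validʸ) (scale-valid ½≥0 validᶻ)
      , (begin
          coeffSum (average Ly Lz)                             ≡⟨ coeffSum-weighted (average Ly Lz) ⟩
          weighted one (average Ly Lz)                         ≡⟨ weighted-average one Ly Lz ⟩
          ½ * (weighted one Ly + weighted one Lz)
            ≡⟨ cong₂ (λ a b → ½ * (a + b)) (represents-const rʸ 1ℚ) (represents-const rᶻ 1ℚ) ⟩
          ½ * (1ℚ + 1ℚ)                                        ≡⟨⟩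
          1ℚ                                                   ∎)
      , lookup-extensionality λ i → begin
          lookup (combine (average Ly Lz)) i                   ≡⟨ lookup-combine (average Ly Lz) i ⟩
          weighted (coord i) (average Ly Lz)                   ≡⟨ weighted-average (coord i) Ly Lz ⟩
          ½ * (weighted (coord i) Ly + weighted (coord i) Lz)
            ≡⟨ cong₂ (λ a b → ½ * (a + b)) (represents-coord rʸ i) (represents-coord rᶻ i) ⟩
          ½ * (lookup y i + lookup z i)                        ≡⟨ lookup-midpoint y z i ⟨
          lookup (midpoint y z) i                              ∎
      where
      open ≡-Reasoning
      ½≥0 : 0ℚ ℚ.≤ ½
      ½≥0 = nonNegative⁻¹ ½

    uniquelyRepresented⇒vertex : ∀ {w} → IsWord m n w → UniquelyRepresented m n w → IsVertex m n (map toℚ w)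
    uniquelyRepresented⇒vertex {w} isWord unique = (_ , word-represents isWord) , extreme
      where
      extreme : ∀ y z → InP m n y → InP m n z → map toℚ w ≡ midpoint y z → y ≡ z
      extreme y z (Ly , rʸ) (Lz , rᶻ) w≡mid
        with suppʸ , suppᶻ ← onSupport-average
                             (unique _ (subst (Represents m n _) (sym w≡mid) (represents-midpoint rʸ rᶻ)))
        = trans (represents-onSupport rʸ suppʸ) (sym (represents-onSupport rᶻ suppᶻ))

    upClosed⇒uniquelyRepresented : ∀ {w} → UpClosed n w → UniquelyRepresented m n w
    upClosed⇒uniquelyRepresented {w} upClosed L r@(valid , _) mem c>0 =
      lookup-extensionality λ i → agreeAt (suc n) i (ℕ.s≤s (ℕ.m∸n≤m n (lookup w i))) mem c>0
      where
      agreeAt : ∀ d i → n ∸ lookup w i ℕ.< d → OnSupport (λ v → lookup v i ≡ lookup w i) L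
      agreeAt d i _ with lookup w i ℕ.≟ 0
      ... | yes wᵢ≡0 = λ mem c>0 →
        trans (represents-zero r i (trans (lookup-map i toℚ w) (cong toℚ wᵢ≡0)) mem c>0) (sym wᵢ≡0)
      agreeAt (suc d) i (ℕ.s≤s bound) | no wᵢ≢0 =
        represents-max r i (λ mem c>0 → ℕ.≮⇒≥ (noneHigher mem c>0)) (lookup-map i toℚ w)
        where
        noneHigher : ∀ {c v} → (c , v) ∈ L → 0ℚ ℚ.< c → lookup w i ℕ.< lookup v i → ⊥
        noneHigher {v = v} mem c>0 wᵢ<vᵢ with All.lookup valid mem
        ... | _ , vᵢ≤n , distinct with upClosed i (lookup v i) wᵢ≢0 wᵢ<vᵢ (vᵢ≤n i)
        ...   | p , wₚ≡vᵢ = distinct p i p≢i vₚ≢0 vₚ≡vᵢ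
          where
          vₚ≡vᵢ : lookup v p ≡ lookup v i
          vₚ≡vᵢ = trans (agreeAt d p (subst (λ t → n ∸ t ℕ.< d) (sym wₚ≡vᵢ)
                                             (ℕ.<-≤-trans (ℕ.∸-monoʳ-< wᵢ<vᵢ (vᵢ≤n i)) bound)) mem c>0) wₚ≡vᵢ
          p≢i : p ≢ i
          p≢i refl = ℕ.<⇒≢ wᵢ<vᵢ wₚ≡vᵢ
          vₚ≢0 : lookup v p ≢ 0
          vₚ≢0 vₚ≡0 = ℕ.<⇒≢ (ℕ.≤-<-trans ℕ.z≤n wᵢ<vᵢ) (sym (trans (sym vₚ≡vᵢ) vₚ≡0))

    positive-entry : ∀ {L} → All (Valid m n) L → 0ℚ ℚ.< coeffSum L → ∃ λ c → ∃ λ w → (c , w) ∈ L × 0ℚ ℚ.< c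
    positive-entry {[]} [] pos = contradiction pos (<-irrefl refl)
    positive-entry {(c , w) ∷ L} ((c≥0 , _) ∷ valid) pos with 0ℚ <? c
    ... | yes c>0 = c , w , here refl , c>0
    ... | no c≯0 with refl ← ≤-antisym (≮⇒≥ c≯0) c≥0
                  with c′ , w′ , mem , c′>0 ← positive-entry valid (subst (0ℚ ℚ.<_) (+-identityˡ (coeffSum L)) pos)
      = c′ , w′ , there mem , c′>0

    module _ {L₁ L₂ : Weights (Vec ℕ m)} {c : ℚ} {w : Vec ℕ m}
             (valid : All (Valid m n) (L₁ ++ (c , w) ∷ L₂)) (total : coeffSum (L₁ ++ (c , w) ∷ L₂) ≡ 1ℚ) where
      private
        L : Weights (Vec ℕ m)
        L = L₁ ++ (c , w) ∷ L₂

        valid₁ : All (Valid m n) L₁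
        valid₁ = proj₁ (All.++⁻ L₁ valid)

        valid₂ : All (Valid m n) ((c , w) ∷ L₂)
        valid₂ = proj₂ (All.++⁻ L₁ valid)

        validᴿ : All (Valid m n) (L₁ ++ L₂)
        validᴿ = All.++⁺ valid₁ (All.tail valid₂)

        total₁ : weighted one L ≡ 1ℚ
        total₁ = trans (sym (coeffSum-weighted L)) total

        1-c≥0 : 0ℚ ℚ.≤ 1ℚ - c
        1-c≥0 = subst (0ℚ ℚ.≤_) (trans (e c (coeffSum (L₁ ++ L₂))) (cong (_- c) (trans (sym split) total)))
                      (coeffSum-nonNeg validᴿ)
          where
          split : coeffSum L ≡ c + coeffSum (L₁ ++ L₂)
          split = trans (coeffSum-weighted L) (trans (weighted-extract one L₁ c w L₂)
                                                     (cong₂ _+_ (*-identityʳ c) (sym (coeffSum-weighted (L₁ ++ L₂)))))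
          e : ∀ c r → r ≡ (c + r) - c
          e = solve 2 (λ c r → r := (c :+ r) :- c) refl

      towards-coord : ∀ i → let x = weighted (coord i) L in lookup (combine (towards c w L)) i ≡ x + c * (coord i w - x)
      towards-coord i = trans (lookup-combine (towards c w L) i) (weighted-towards (coord i) c w L)

      away-coord : ∀ i → let x = weighted (coord i) L in lookup (combine (away c w L₁ L₂)) i ≡ x - c * (coord i w - x)
      away-coord i = trans (lookup-combine (away c w L₁ L₂) i) (weighted-away (coord i) c w L₁ L₂)

      towards-represents : Represents m n (towards c w L) (combine (towards c w L))
      towards-represents = All.head valid₂ ∷ scale-valid 1-c≥0 valid , total′ , refl
        where
        open ≡-Reasoning
        total′ : coeffSum (towards c w L) ≡ 1ℚ
        total′ = begin
          coeffSum (towards c w L)                    ≡⟨ coeffSum-weighted (towards c w L) ⟩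
          weighted one (towards c w L)                ≡⟨ weighted-towards one c w L ⟩
          weighted one L + c * (1ℚ - weighted one L)  ≡⟨ cong (λ t → t + c * (1ℚ - t)) total₁ ⟩
          1ℚ + c * (1ℚ - 1ℚ)                          ≡⟨ solve 1 (λ c → con 1ℚ :+ c :* con 0ℚ := con 1ℚ) refl c ⟩
          1ℚ                                          ∎

      away-represents : Represents m n (away c w L₁ L₂) (combine (away c w L₁ L₂))
      away-represents = (*-nonNeg c≥0 c≥0 , proj₂ (All.head valid₂)) ∷ scale-valid 1+c≥0 validᴿ , total′ , refl
        where
        open ≡-Reasoning
        c≥0 : 0ℚ ℚ.≤ c
        c≥0 = proj₁ (All.head valid₂)
        1+c≥0 : 0ℚ ℚ.≤ 1ℚ + c
        1+c≥0 = +-mono-≤ (nonNegative⁻¹ 1ℚ) c≥0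
        total′ : coeffSum (away c w L₁ L₂) ≡ 1ℚ
        total′ = begin
          coeffSum (away c w L₁ L₂)                   ≡⟨ coeffSum-weighted (away c w L₁ L₂) ⟩
          weighted one (away c w L₁ L₂)               ≡⟨ weighted-away one c w L₁ L₂ ⟩
          weighted one L - c * (1ℚ - weighted one L)  ≡⟨ cong (λ t → t - c * (1ℚ - t)) total₁ ⟩
          1ℚ - c * (1ℚ - 1ℚ)                          ≡⟨ solve 1 (λ c → con 1ℚ :- c :* con 0ℚ := con 1ℚ) refl c ⟩
          1ℚ                                          ∎

      towards-away-midpoint : combine L ≡ midpoint (combine (towards c w L)) (combine (away c w L₁ L₂))
      towards-away-midpoint = lookup-extensionality λ i → begin
        lookup (combine L) i
          ≡⟨ lookup-combine L i ⟩
        weighted (coord i) L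
          ≡⟨ midpoint-± c (coord i w) (weighted (coord i) L) ⟩
        ½ * ((weighted (coord i) L + c * (coord i w - weighted (coord i) L))
              + (weighted (coord i) L - c * (coord i w - weighted (coord i) L)))
          ≡⟨ cong₂ (λ a b → ½ * (a + b)) (towards-coord i) (away-coord i) ⟨
        ½ * (lookup (combine (towards c w L)) i + lookup (combine (away c w L₁ L₂)) i)
          ≡⟨ lookup-midpoint (combine (towards c w L)) (combine (away c w L₁ L₂)) i ⟨
        lookup (midpoint (combine (towards c w L)) (combine (away c w L₁ L₂))) i
          ∎
        where open ≡-Reasoning

    vertex-onSupport : ∀ {x L} → IsVertex m n x → Represents m n L x → OnSupport (λ w → x ≡ map toℚ w) L
    vertex-onSupport {L = L} (_ , extreme) (valid , total , refl) {c} {w} cw∈L c>0 with ∈-∃++ cw∈L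
    ... | L₁ , L₂ , refl = lookup-extensionality λ i → begin
      lookup (combine L) i   ≡⟨ lookup-combine L i ⟩
      weighted (coord i) L   ≡⟨ ±-equal⇒≡ c>0 (trans (sym (towards-coord valid total i))
                                                (trans (cong (λ p → lookup p i) towards≡away)
                                                       (away-coord valid total i))) ⟩
      coord i w              ≡⟨ lookup-map i toℚ w ⟨
      lookup (map toℚ w) i   ∎
      where
      open ≡-Reasoning
      towards≡away : combine (towards c w L) ≡ combine (away c w L₁ L₂)
      towards≡away = extreme _ _ (_ , towards-represents valid total) (_ , away-represents valid total)
                               (towards-away-midpoint valid total)

    vertex⇒word : ∀ {x} → IsVertex m n x → ∃ λ w → IsWord m n w × x ≡ map toℚ w
    vertex⇒word vertex@((L , r@(valid , total , _)) , _)
      with c , w , cw∈L , c>0 ← positive-entry valid (subst (0ℚ ℚ.<_) (sym total) (positive⁻¹ 1ℚ))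
      = w , proj₂ (All.lookup valid cw∈L) , vertex-onSupport vertex r cw∈L c>0

  raise : ℕ → ℕ → ℕ
  raise u zero = zero
  raise u (suc t) with suc t ℕ.<? u
  ... | yes _ = suc (suc t)
  ... | no _ = suc t

  lower : ℕ → ℕ → ℕ
  lower u zero = zero
  lower u (suc t) with suc t ℕ.<? u
  ... | yes _ = t
  ... | no _ = suc t

  raise-lower-midpoint : ∀ u t → toℚ t ≡ ½ * (toℚ (raise u t) + toℚ (lower u t))
  raise-lower-midpoint u zero = refl
  raise-lower-midpoint u (suc t) with suc t ℕ.<? u
  ... | yes _ = begin
    toℚ (1 ℕ.+ t)                    ≡⟨ toℚ-+ 1 t ⟩
    1ℚ + toℚ t                       ≡⟨ e (toℚ t) ⟩
    ½ * ((1ℚ + 1ℚ + toℚ t) + toℚ t)  ≡⟨ cong (λ a → ½ * (a + toℚ t)) (toℚ-+ 2 t) ⟨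
    ½ * (toℚ (2 ℕ.+ t) + toℚ t)      ∎
    where
    open ≡-Reasoning
    e : ∀ x → 1ℚ + x ≡ ½ * ((1ℚ + 1ℚ + x) + x)
    e = solve 1 (λ x → con 1ℚ :+ x := con ½ :* ((con 1ℚ :+ con 1ℚ :+ x) :+ x)) refl
  ... | no _ = solve 1 (λ x → x := con ½ :* (x :+ x)) refl (toℚ (suc t))

  raise-≤ : ∀ {u n t} → u ℕ.≤ n → t ℕ.≤ n → raise u t ℕ.≤ n
  raise-≤ {u} {t = zero} u≤n t≤n = ℕ.z≤n
  raise-≤ {u} {t = suc t} u≤n t≤n with suc t ℕ.<? u
  ... | yes t<u = ℕ.≤-trans t<u u≤n
  ... | no _ = t≤n

  lower-≤ : ∀ u t → lower u t ℕ.≤ t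
  lower-≤ u zero = ℕ.z≤n
  lower-≤ u (suc t) with suc t ℕ.<? u
  ... | yes _ = ℕ.n≤1+n t
  ... | no _ = ℕ.≤-refl

  raise-injective : ∀ {u s t} → s ≢ t → s ≢ u → t ≢ u → raise u s ≢ raise u t
  raise-injective {u} {zero} {zero} s≢t _ _ = contradiction refl s≢t
  raise-injective {u} {zero} {suc t} _ _ _ with suc t ℕ.<? u
  ... | yes _ = λ ()
  ... | no _ = λ ()
  raise-injective {u} {suc s} {zero} _ _ _ with suc s ℕ.<? u
  ... | yes _ = λ ()
  ... | no _ = λ ()
  raise-injective {u} {suc s} {suc t} s≢t s≢u t≢u with suc s ℕ.<? u | suc t ℕ.<? u
  ... | yes _ | yes _ = λ eq → s≢t (ℕ.suc-injective eq)
  ... | no _ | no _ = s≢t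
  ... | yes s<u | no t≮u = λ eq → t≢u (ℕ.≤-antisym (subst (ℕ._≤ u) eq s<u) (ℕ.≮⇒≥ t≮u))
  ... | no s≮u | yes t<u = λ eq → s≢u (ℕ.≤-antisym (subst (ℕ._≤ u) (sym eq) t<u) (ℕ.≮⇒≥ s≮u))

  lower-injective : ∀ {u s t} → lower u s ≢ 0 → s ≢ t → lower u s ≢ lower u t
  lower-injective {u} {zero} s≢0 _ = contradiction refl s≢0
  lower-injective {u} {suc s} {zero} s≢0 _ with suc s ℕ.<? u
  ... | yes _ = s≢0
  ... | no _ = s≢0
  lower-injective {u} {suc s} {suc t} _ s≢t with suc s ℕ.<? u | suc t ℕ.<? u
  ... | yes _ | yes _ = λ eq → s≢t (cong suc eq)
  ... | no _ | no _ = s≢t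
  ... | yes s<u | no t≮u = λ eq → t≮u (ℕ.<-trans (subst (ℕ._< suc s) eq (ℕ.n<1+n s)) s<u)
  ... | no s≮u | yes t<u = λ eq → s≮u (ℕ.<-trans (subst (ℕ._< suc t) (sym eq) (ℕ.n<1+n t)) t<u)

  raise≢lower : ∀ {u a} → a ≢ 0 → a ℕ.< u → raise u a ≢ lower u a
  raise≢lower {u} {zero} a≢0 _ = contradiction refl a≢0
  raise≢lower {u} {suc a} _ a<u with suc a ℕ.<? u
  ... | yes _ = λ eq → ℕ.<⇒≢ (ℕ.<-trans (ℕ.n<1+n a) (ℕ.n<1+n (suc a))) (sym eq)
  ... | no a≮u = contradiction a<u a≮u

  midpoint-map : ∀ {k} {f g : ℕ → ℕ} → (∀ t → toℚ t ≡ ½ * (toℚ (f t) + toℚ (g t))) →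
                 ∀ (w : Vec ℕ k) → map toℚ w ≡ midpoint (map toℚ (map f w)) (map toℚ (map g w))
  midpoint-map {f = f} {g} mid w = lookup-extensionality λ i → begin
    lookup (map toℚ w) i                                       ≡⟨ lookup-map i toℚ w ⟩
    toℚ (lookup w i)                                           ≡⟨ mid (lookup w i) ⟩
    ½ * (toℚ (f (lookup w i)) + toℚ (g (lookup w i)))
      ≡⟨ cong₂ (λ a b → ½ * (a + b)) (toℚ-map f i) (toℚ-map g i) ⟨
    ½ * (lookup (map toℚ (map f w)) i + lookup (map toℚ (map g w)) i)
      ≡⟨ lookup-midpoint (map toℚ (map f w)) (map toℚ (map g w)) i ⟨
    lookup (midpoint (map toℚ (map f w)) (map toℚ (map g w))) i
      ∎
    where
    open ≡-Reasoning
    toℚ-map : ∀ h i → lookup (map toℚ (map h w)) i ≡ toℚ (h (lookup w i))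
    toℚ-map h i = trans (lookup-map i toℚ (map h w)) (cong toℚ (lookup-map i h w))

  module _ {m n : ℕ} where
    map-isWord : ∀ {f} w → IsWord m n w → f 0 ≡ 0 → (∀ i → f (lookup w i) ℕ.≤ n) →
                 (∀ i j → lookup w i ≢ lookup w j → f (lookup w i) ≢ 0 → f (lookup w i) ≢ f (lookup w j)) →
                 IsWord m n (map f w)
    map-isWord {f} w (_ , distinct) f0≡0 bounded injective = bounded′ , distinct′
      where
      bounded′ : ∀ i → lookup (map f w) i ℕ.≤ n
      bounded′ i rewrite lookup-map i f w = bounded i
      distinct′ : NonzeroDistinct (map f w)
      distinct′ i j i≢j rewrite lookup-map i f w | lookup-map j f w = λ fwᵢ≢0 →
        injective i j (distinct i j i≢j λ wᵢ≡0 → fwᵢ≢0 (trans (cong f wᵢ≡0) f0≡0)) fwᵢ≢0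

    vertex⇒upClosed : ∀ {w} → IsWord m n w → IsVertex m n (map toℚ w) → UpClosed n w
    vertex⇒upClosed {w} isWord@(bounded , _) (_ , extreme) i u wᵢ≢0 wᵢ<u u≤n with any? (λ p → lookup w p ℕ.≟ u)
    ... | yes present = present
    ... | no absent = contradiction (begin
      raise u (lookup w i)        ≡⟨ lookup-map i (raise u) w ⟨
      lookup (map (raise u) w) i  ≡⟨ cong (λ v → lookup v i) (map-toℚ-injective raised≡lowered) ⟩
      lookup (map (lower u) w) i  ≡⟨ lookup-map i (lower u) w ⟩
      lower u (lookup w i)        ∎) (raise≢lower wᵢ≢0 wᵢ<u)
      where
      open ≡-Reasoning
      raised : IsWord m n (map (raise u) w)
      raised = map-isWord w isWord refl (λ p → raise-≤ u≤n (bounded p))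
                          (λ p q wₚ≢w_q _ → raise-injective wₚ≢w_q (λ e → absent (p , e)) (λ e → absent (q , e)))
      lowered : IsWord m n (map (lower u) w)
      lowered = map-isWord w isWord refl (λ p → ℕ.≤-trans (lower-≤ u (lookup w p)) (bounded p))
                           (λ p q wₚ≢w_q lowerₚ≢0 → lower-injective lowerₚ≢0 wₚ≢w_q)
      raised≡lowered : map toℚ (map (raise u) w) ≡ map toℚ (map (lower u) w)
      raised≡lowered = extreme _ _ (_ , word-represents raised) (_ , word-represents lowered)
                               (midpoint-map (raise-lower-midpoint u) w)

    vertex⇔upClosedWord : ∀ x → IsVertex m n x ⇔ (∃ λ w → IsUpClosedWord m n w × x ≡ map toℚ w)
    vertex⇔upClosedWord x = mk⇔ to from
      where
      to : IsVertex m n x → ∃ λ w → IsUpClosedWord m n w × x ≡ map toℚ w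
      to vertex with w , isWord , refl ← vertex⇒word vertex = w , (isWord , vertex⇒upClosed isWord vertex) , refl
      from : (∃ λ w → IsUpClosedWord m n w × x ≡ map toℚ w) → IsVertex m n x
      from (w , (isWord , upClosed) , refl) =
        uniquelyRepresented⇒vertex isWord (upClosed⇒uniquelyRepresented upClosed)

module Arrangements where
  open import Data.Nat using (zero; _+_; _*_; _∸_; _/_; _≟_; _!; pred; z≤n; s≤s)
  open import Data.Nat.Properties
  open import Data.Nat.DivMod using (m*n/n≡m)
  open import Data.Nat.ListAction using (sum)
  open import Data.Nat.Solver using (module +-*-Solver)
  open import Data.Fin using () renaming (zero to fzero; suc to fsuc)
  import Data.Fin.Properties as Fin
  open import Data.Vec using ([]; _∷_; head)
  import Data.Vec.Properties as Vec
  open import Data.List using ([]; _∷_; _++_; [_]; map; concatMap; filter; applyUpTo)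
  open import Data.List.Properties
    using (length-++; length-map; map-cong-local; filter-accept; filter-reject; filter-all)
  open import Data.List.Membership.Propositional using (_∉_; find)
  open import Data.List.Membership.Propositional.Properties
    using ( ∈-++⁺ˡ; ∈-++⁺ʳ; ∈-++⁻; ∈-map⁺; ∈-map⁻; ∈-concatMap⁺; ∈-concatMap⁻; ∈-filter⁺; ∈-filter⁻
          ; ∈-applyUpTo⁺; ∈-applyUpTo⁻)
  open import Data.List.Relation.Unary.Any as Any using (here; there)
  open import Data.List.Relation.Unary.All as All using (All; []; _∷_)
  open import Data.List.Relation.Unary.AllPairs using ([]; _∷_)
  import Data.List.Relation.Unary.Unique.Propositional.Properties as Unique
  open import Data.Product using (proj₁; proj₂)
  open import Data.Sum using (_⊎_; inj₁; inj₂) renaming (map₁ to ⊎-map₁)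
  open import Function using (_∘_)
  open import Relation.Binary.PropositionalEquality
    using (refl; sym; trans; cong; cong₂; subst; ≢-sym; module ≡-Reasoning)
  open import Relation.Nullary using (¬_; yes; no; ¬?; contradiction)
  open import Relation.Unary using (Decidable)
  open import Data.Empty using (⊥)

  length-concatMap : ∀ {A B : Set} (f : A → List B) xs → length (concatMap f xs) ≡ sum (map (length ∘ f) xs)
  length-concatMap f [] = refl
  length-concatMap f (x ∷ xs) = trans (length-++ (f x)) (cong (length (f x) +_) (length-concatMap f xs))

  sum-map-const : ∀ {A : Set} c (xs : List A) → sum (map (λ _ → c) xs) ≡ length xs * c
  sum-map-const c [] = refl
  sum-map-const c (x ∷ xs) = cong (c +_) (sum-map-const c xs)

  concatMap-unique : ∀ {A B : Set} (f : A → List B) {xs} → Unique xs → (∀ {x} → x ∈ xs → Unique (f x)) →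
                     (∀ {x y b} → x ∈ xs → y ∈ xs → b ∈ f x → b ∈ f y → x ≡ y) → Unique (concatMap f xs)
  concatMap-unique f {[]} [] _ _ = []
  concatMap-unique f {x ∷ xs} (x∉xs ∷ unique) blockUnique determined =
    Unique.++⁺ (blockUnique (here refl))
               (concatMap-unique f unique (blockUnique ∘ there) (λ x∈ y∈ → determined (there x∈) (there y∈)))
               λ (b∈fx , b∈rest) → let y , y∈xs , b∈fy = find (∈-concatMap⁻ f {xs = xs} b∈rest) in
                 All.lookup x∉xs y∈xs (determined (here refl) (there y∈xs) b∈fx b∈fy)

  ∈-map-∷⇒head : ∀ {k v} {x : Vec ℕ (suc k)} {A : List (Vec ℕ k)} → x ∈ map (v ∷_) A → head x ≡ v
  ∈-map-∷⇒head {v = v} mem with _ , _ , refl ← ∈-map⁻ (v ∷_) mem = refl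

  longest-prefix : ∀ {P : ℕ → Set} → Decidable P → ∀ n →
                   ∃ λ j → j ≤ n × (∀ k → k < j → P k) × (j ≡ n ⊎ ¬ P j)
  longest-prefix P? zero = 0 , z≤n , (λ _ ()) , inj₁ refl
  longest-prefix {P} P? (suc n) with P? 0
  ... | no ¬P0 = 0 , z≤n , (λ _ ()) , inj₂ ¬P0
  ... | yes P0 with j , j≤n , prefix , stop ← longest-prefix (P? ∘ suc) n =
    suc j , s≤s j≤n , prefix′ , ⊎-map₁ (cong suc) stop
    where
    prefix′ : ∀ k → k < suc j → P k
    prefix′ zero _ = P0
    prefix′ (suc k) (s≤s k<j) = prefix k k<j

  fallingFactorial : ℕ → ℕ → ℕ
  fallingFactorial _ zero = 1
  fallingFactorial zero (suc j) = 0
  fallingFactorial (suc m) (suc j) = suc m * fallingFactorial m j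

  fallingFactorial-suc : ∀ m s →
                         fallingFactorial m s + s * fallingFactorial m (pred s) ≡ fallingFactorial (suc m) s
  fallingFactorial-suc m zero = refl
  fallingFactorial-suc zero (suc zero) = refl
  fallingFactorial-suc zero (suc (suc j)) = *-zeroʳ (suc (suc j))
  fallingFactorial-suc (suc m) (suc zero) =
    solve 1 (λ m → (con 1 :+ m) :* con 1 :+ con 1 := (con 2 :+ m) :* con 1) refl m
    where open +-*-Solver
  fallingFactorial-suc (suc m) (suc (suc j)) = begin
    suc m * G + suc (suc j) * (suc m * F)   ≡⟨ e₁ m j F G ⟩
    suc m * (G + suc j * F) + suc m * F     ≡⟨ cong (λ t → suc m * t + suc m * F) (fallingFactorial-suc m (suc j)) ⟩
    suc m * (suc m * F) + suc m * F         ≡⟨ e₂ m F ⟩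
    suc (suc m) * (suc m * F)               ∎
    where
    open ≡-Reasoning
    open +-*-Solver
    F = fallingFactorial m j
    G = fallingFactorial m (suc j)
    e₁ : ∀ m j F G → suc m * G + suc (suc j) * (suc m * F) ≡ suc m * (G + suc j * F) + suc m * F
    e₁ = solve 4 (λ m j F G → (con 1 :+ m) :* G :+ (con 2 :+ j) :* ((con 1 :+ m) :* F)
                             := (con 1 :+ m) :* (G :+ (con 1 :+ j) :* F) :+ (con 1 :+ m) :* F) refl
    e₂ : ∀ m F → suc m * (suc m * F) + suc m * F ≡ suc (suc m) * (suc m * F)
    e₂ = solve 2 (λ m F → (con 1 :+ m) :* ((con 1 :+ m) :* F) :+ (con 1 :+ m) :* F
                         := (con 2 :+ m) :* ((con 1 :+ m) :* F)) refl

  fallingFactorial-* : ∀ {m j} → j ≤ m → fallingFactorial m j * (m ∸ j) ! ≡ m !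
  fallingFactorial-* {m} {zero} _ = +-identityʳ (m !)
  fallingFactorial-* {suc m} {suc j} (s≤s j≤m) =
    trans (*-assoc (suc m) (fallingFactorial m j) _) (cong (suc m *_) (fallingFactorial-* j≤m))

  fallingFactorial-> : ∀ {m j} → m < j → fallingFactorial m j ≡ 0
  fallingFactorial-> {zero} {suc j} _ = refl
  fallingFactorial-> {suc m} {suc j} (s≤s m<j) =
    trans (cong (suc m *_) (fallingFactorial-> m<j)) (*-zeroʳ (suc m))

  factQuot≡fallingFactorial : ∀ {m k} → k ≤ m → factQuot m k ≡ fallingFactorial m (m ∸ k)
  factQuot≡fallingFactorial {m} {k} k≤m = begin
    (m ! / k !) {{k !≢0}}                               ≡⟨ cong (λ t → (t / k !) {{k !≢0}}) m!≡ ⟨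
    (fallingFactorial m (m ∸ k) * k ! / k !) {{k !≢0}}  ≡⟨ m*n/n≡m (fallingFactorial m (m ∸ k)) (k !) {{k !≢0}} ⟩
    fallingFactorial m (m ∸ k)                          ∎
    where
    open ≡-Reasoning
    m!≡ : fallingFactorial m (m ∸ k) * k ! ≡ m !
    m!≡ = subst (λ t → fallingFactorial m (m ∸ k) * t ! ≡ m !) (m∸[m∸n]≡n k≤m) (fallingFactorial-* (m∸n≤m m k))

  delete : ℕ → List ℕ → List ℕ
  delete v = filter (λ x → ¬? (x ≟ v))

  ∈-delete⁻ : ∀ {x v} S → x ∈ delete v S → x ∈ S × x ≢ v
  ∈-delete⁻ {v = v} S = ∈-filter⁻ (λ x → ¬? (x ≟ v)) {xs = S}

  ∈-delete⁺ : ∀ {x v S} → x ∈ S → x ≢ v → x ∈ delete v S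
  ∈-delete⁺ {v = v} = ∈-filter⁺ (λ x → ¬? (x ≟ v))

  delete-unique : ∀ {v S} → Unique S → Unique (delete v S)
  delete-unique {v} = Unique.filter⁺ (λ x → ¬? (x ≟ v))

  length-delete : ∀ {v S} → Unique S → v ∈ S → suc (length (delete v S)) ≡ length S
  length-delete {v} {x ∷ S} (x∉S ∷ _) (here refl) = cong (suc ∘ length) (begin
    delete x (x ∷ S)      ≡⟨ filter-reject (λ y → ¬? (y ≟ x)) (λ x≢x → x≢x refl) ⟩
    delete x S            ≡⟨ filter-all (λ y → ¬? (y ≟ x)) (All.map ≢-sym x∉S) ⟩
    S                     ∎)
    where open ≡-Reasoning
  length-delete {v} {x ∷ S} (x∉S ∷ unique) (there v∈S)
    rewrite filter-accept (λ y → ¬? (y ≟ v)) {x} {S} (All.lookup x∉S v∈S) = cong suc (length-delete unique v∈S)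

  module _ {m : ℕ} where
    nonzeroDistinct-∷⁺ : ∀ {v} {w : Vec ℕ m} → (v ≢ 0 → ∀ j → lookup w j ≢ v) → NonzeroDistinct w →
                         NonzeroDistinct (v ∷ w)
    nonzeroDistinct-∷⁺ fresh distinct fzero fzero 0≢0 = contradiction refl 0≢0
    nonzeroDistinct-∷⁺ fresh distinct fzero (fsuc j) _ v≢0 = ≢-sym (fresh v≢0 j)
    nonzeroDistinct-∷⁺ fresh distinct (fsuc i) fzero _ wᵢ≢0 wᵢ≡v = fresh (λ v≡0 → wᵢ≢0 (trans wᵢ≡v v≡0)) i wᵢ≡v
    nonzeroDistinct-∷⁺ fresh distinct (fsuc i) (fsuc j) i≢j = distinct i j (i≢j ∘ cong fsuc)

    nonzeroDistinct-head : ∀ {v} {w : Vec ℕ m} → NonzeroDistinct (v ∷ w) → v ≢ 0 → ∀ j → lookup w j ≢ v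
    nonzeroDistinct-head distinct v≢0 j = ≢-sym (distinct fzero (fsuc j) (λ ()) v≢0)

    nonzeroDistinct-tail : ∀ {v} {w : Vec ℕ m} → NonzeroDistinct (v ∷ w) → NonzeroDistinct w
    nonzeroDistinct-tail distinct i j i≢j = distinct (fsuc i) (fsuc j) (i≢j ∘ Fin.suc-injective)

  record IsArrangement {m} (S : List ℕ) (w : Vec ℕ m) : Set where
    constructor mkArrangement
    field
      values : ∀ i → lookup w i ≢ 0 → lookup w i ∈ S
      occurs : ∀ v → v ∈ S → ∃ λ i → lookup w i ≡ v
      distinct : NonzeroDistinct w

  module _ {m : ℕ} {S : List ℕ} {w : Vec ℕ m} where
    arrangement-0∷⁺ : IsArrangement S w → IsArrangement S (0 ∷ w)
    arrangement-0∷⁺ (mkArrangement values occurs distinct) =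
      mkArrangement values′ occurs′ (nonzeroDistinct-∷⁺ (λ 0≢0 → contradiction refl 0≢0) distinct)
      where
      values′ : ∀ i → lookup (0 ∷ w) i ≢ 0 → lookup (0 ∷ w) i ∈ S
      values′ fzero 0≢0 = contradiction refl 0≢0
      values′ (fsuc i) = values i
      occurs′ : ∀ v → v ∈ S → ∃ λ i → lookup (0 ∷ w) i ≡ v
      occurs′ v v∈S with i , wᵢ≡v ← occurs v v∈S = fsuc i , wᵢ≡v

    arrangement-0∷⁻ : 0 ∉ S → IsArrangement S (0 ∷ w) → IsArrangement S w
    arrangement-0∷⁻ 0∉S (mkArrangement values occurs distinct) =
      mkArrangement (values ∘ fsuc) occurs′ (nonzeroDistinct-tail distinct)
      where
      occurs′ : ∀ v → v ∈ S → ∃ λ i → lookup w i ≡ v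
      occurs′ v v∈S with occurs v v∈S
      ... | fzero , refl = contradiction v∈S 0∉S
      ... | fsuc i , wᵢ≡v = i , wᵢ≡v

    arrangement-∷⁺ : ∀ {v} → v ∈ S → IsArrangement (delete v S) w → IsArrangement S (v ∷ w)
    arrangement-∷⁺ {v} v∈S (mkArrangement values occurs distinct) =
      mkArrangement values′ occurs′ (nonzeroDistinct-∷⁺ fresh distinct)
      where
      values′ : ∀ i → lookup (v ∷ w) i ≢ 0 → lookup (v ∷ w) i ∈ S
      values′ fzero _ = v∈S
      values′ (fsuc i) wᵢ≢0 = proj₁ (∈-delete⁻ S (values i wᵢ≢0))
      occurs′ : ∀ x → x ∈ S → ∃ λ i → lookup (v ∷ w) i ≡ x
      occurs′ x x∈S with x ≟ v
      ... | yes refl = fzero , refl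
      ... | no x≢v with i , wᵢ≡x ← occurs x (∈-delete⁺ x∈S x≢v) = fsuc i , wᵢ≡x
      fresh : v ≢ 0 → ∀ j → lookup w j ≢ v
      fresh v≢0 j wⱼ≡v = proj₂ (∈-delete⁻ S (values j (λ wⱼ≡0 → v≢0 (trans (sym wⱼ≡v) wⱼ≡0)))) wⱼ≡v

    arrangement-∷⁻ : ∀ {v} → v ≢ 0 → IsArrangement S (v ∷ w) → v ∈ S × IsArrangement (delete v S) w
    arrangement-∷⁻ {v} v≢0 (mkArrangement values occurs distinct) =
      values fzero v≢0 , mkArrangement values′ occurs′ (nonzeroDistinct-tail distinct)
      where
      values′ : ∀ i → lookup w i ≢ 0 → lookup w i ∈ delete v S
      values′ i wᵢ≢0 = ∈-delete⁺ (values (fsuc i) wᵢ≢0) (nonzeroDistinct-head distinct v≢0 i)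
      occurs′ : ∀ x → x ∈ delete v S → ∃ λ i → lookup w i ≡ x
      occurs′ x x∈S′ with x∈S , x≢v ← ∈-delete⁻ S x∈S′ with occurs x x∈S
      ... | fzero , v≡x = contradiction (sym v≡x) x≢v
      ... | fsuc i , wᵢ≡x = i , wᵢ≡x

  arrangements : (m : ℕ) → List ℕ → List (Vec ℕ m)
  startingWith : (m : ℕ) → List ℕ → ℕ → List (Vec ℕ (suc m))

  arrangements zero [] = [ [] ]
  arrangements zero (_ ∷ _) = []
  arrangements (suc m) S = map (0 ∷_) (arrangements m S) ++ concatMap (startingWith m S) S

  startingWith m S v = map (v ∷_) (arrangements m (delete v S))

  arrangements-sound : ∀ m S {w : Vec ℕ m} → w ∈ arrangements m S → IsArrangement S w
  arrangements-sound zero [] (here refl) = mkArrangement (λ ()) (λ _ ()) (λ ())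
  arrangements-sound (suc m) S mem with ∈-++⁻ (map (0 ∷_) (arrangements m S)) mem
  ... | inj₁ mem₀ with w , w∈ , refl ← ∈-map⁻ (0 ∷_) mem₀ = arrangement-0∷⁺ (arrangements-sound m S w∈)
  ... | inj₂ memᵥ with v , v∈S , mem′ ← find (∈-concatMap⁻ (startingWith m S) {xs = S} memᵥ)
                   with w , w∈ , refl ← ∈-map⁻ (v ∷_) mem′
    = arrangement-∷⁺ v∈S (arrangements-sound m (delete v S) w∈)

  arrangements-complete : ∀ m S {w : Vec ℕ m} → 0 ∉ S → IsArrangement S w → w ∈ arrangements m S
  arrangements-complete zero [] {[]} _ _ = here refl
  arrangements-complete zero (v ∷ S) {[]} _ (mkArrangement _ occurs _) with () , _ ← occurs v (here refl)
  arrangements-complete (suc m) S {a ∷ w} 0∉S arrangement with a ≟ 0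
  ... | yes refl = ∈-++⁺ˡ (∈-map⁺ (0 ∷_) (arrangements-complete m S 0∉S (arrangement-0∷⁻ 0∉S arrangement)))
  ... | no a≢0 with a∈S , arrangement′ ← arrangement-∷⁻ a≢0 arrangement =
    ∈-++⁺ʳ _ (∈-concatMap⁺ (startingWith m S) (Any.map (λ { refl → ∈-map⁺ (a ∷_) w∈ }) a∈S))
    where
    w∈ : w ∈ arrangements m (delete a S)
    w∈ = arrangements-complete m (delete a S) (0∉S ∘ proj₁ ∘ ∈-delete⁻ S) arrangement′

  arrangements-unique : ∀ m {S} → Unique S → 0 ∉ S → Unique (arrangements m S)
  arrangements-unique zero {[]} _ _ = [] ∷ []
  arrangements-unique zero {_ ∷ _} _ _ = []
  arrangements-unique (suc m) {S} unique 0∉S =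
    Unique.++⁺ (Unique.map⁺ Vec.∷-injectiveʳ (arrangements-unique m unique 0∉S))
               (concatMap-unique (startingWith m S) unique (λ _ → startingWith-unique)
                                 (λ _ _ mem mem′ → trans (sym (∈-map-∷⇒head mem)) (∈-map-∷⇒head mem′)))
               λ (mem₀ , memᵥ) → let v , v∈S , mem = find (∈-concatMap⁻ (startingWith m S) {xs = S} memᵥ) in
                 0∉S (subst (_∈ S) (trans (sym (∈-map-∷⇒head mem)) (∈-map-∷⇒head mem₀)) v∈S)
    where
    startingWith-unique : ∀ {v} → Unique (startingWith m S v)
    startingWith-unique {v} = Unique.map⁺ Vec.∷-injectiveʳ
      (arrangements-unique m (delete-unique unique) (0∉S ∘ proj₁ ∘ ∈-delete⁻ S))

  length-arrangements : ∀ m {S} → Unique S → length (arrangements m S) ≡ fallingFactorial m (length S)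
  length-arrangements zero {[]} _ = refl
  length-arrangements zero {_ ∷ _} _ = refl
  length-arrangements (suc m) {S} unique = begin
    length (map (0 ∷_) (arrangements m S) ++ concatMap (startingWith m S) S)
      ≡⟨ length-++ (map (0 ∷_) (arrangements m S)) ⟩
    length (map (0 ∷_) (arrangements m S)) + length (concatMap (startingWith m S) S)
      ≡⟨ cong₂ _+_ (trans (length-map (0 ∷_) (arrangements m S)) (length-arrangements m unique)) blocks ⟩
    fallingFactorial m (length S) + length S * fallingFactorial m (pred (length S))
      ≡⟨ fallingFactorial-suc m (length S) ⟩
    fallingFactorial (suc m) (length S)
      ∎
    where
    open ≡-Reasoning
    blockLength : ∀ {v} → v ∈ S → length (startingWith m S v) ≡ fallingFactorial m (pred (length S))
    blockLength {v} v∈S = begin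
      length (startingWith m S v)                    ≡⟨ length-map (v ∷_) (arrangements m (delete v S)) ⟩
      length (arrangements m (delete v S))           ≡⟨ length-arrangements m (delete-unique unique) ⟩
      fallingFactorial m (length (delete v S))       ≡⟨ cong (fallingFactorial m ∘ pred) (length-delete unique v∈S) ⟩
      fallingFactorial m (pred (length S))           ∎
    blocks : length (concatMap (startingWith m S) S) ≡ length S * fallingFactorial m (pred (length S))
    blocks = begin
      length (concatMap (startingWith m S) S)                          ≡⟨ length-concatMap (startingWith m S) S ⟩
      sum (map (length ∘ startingWith m S) S)                  ≡⟨ cong sum (map-cong-local (All.tabulate blockLength)) ⟩
      sum (map (λ _ → fallingFactorial m (pred (length S))) S)         ≡⟨ sum-map-const _ S ⟩
      length S * fallingFactorial m (pred (length S))                  ∎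

  arrangement-length-≤ : ∀ {m S} {w : Vec ℕ m} → Unique S → 0 ∉ S → IsArrangement S w → length S ≤ m
  arrangement-length-≤ {m} {S} {w} unique 0∉S arrangement = ≮⇒≥ λ m<|S| →
    nonEmpty (arrangements-complete m S {w} 0∉S arrangement)
             (trans (length-arrangements m unique) (fallingFactorial-> m<|S|))
    where
    nonEmpty : ∀ {A : Set} {x : A} {xs} → x ∈ xs → length xs ≢ 0
    nonEmpty (here _) ()
    nonEmpty (there _) ()

  topValues : ℕ → ℕ → List ℕ
  topValues n j = applyUpTo (n ∸_) j

  module _ {n j : ℕ} where
    topValues-unique : j ≤ n → Unique (topValues n j)
    topValues-unique j≤n = Unique.applyUpTo⁺₁ (n ∸_) j λ i<k k<j →
      ≢-sym (<⇒≢ (∸-monoʳ-< i<k (≤-trans (<⇒≤ k<j) j≤n)))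

    0∉topValues : j ≤ n → 0 ∉ topValues n j
    0∉topValues j≤n mem with k , k<j , 0≡n∸k ← ∈-applyUpTo⁻ (n ∸_) mem =
      <⇒≢ (m<n⇒0<n∸m (<-≤-trans k<j j≤n)) 0≡n∸k

    ∈-topValues : ∀ {v} → v ≤ n → n ∸ v < j → v ∈ topValues n j
    ∈-topValues {v} v≤n n∸v<j = subst (_∈ topValues n j) (m∸[m∸n]≡n v≤n) (∈-applyUpTo⁺ (n ∸_) n∸v<j)

  module _ {m n j : ℕ} {w : Vec ℕ m} where
    topArrangement⇒upClosedWord : j ≤ n → IsArrangement (topValues n j) w → IsUpClosedWord m n w
    topArrangement⇒upClosedWord j≤n (mkArrangement values occurs distinct) = (bounded , distinct) , upClosed
      where
      bounded : ∀ i → lookup w i ≤ n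
      bounded i with lookup w i ≟ 0
      ... | yes wᵢ≡0 = subst (_≤ n) (sym wᵢ≡0) z≤n
      ... | no wᵢ≢0 with k , _ , wᵢ≡n∸k ← ∈-applyUpTo⁻ (n ∸_) (values i wᵢ≢0) =
        subst (_≤ n) (sym wᵢ≡n∸k) (m∸n≤m n k)
      upClosed : UpClosed n w
      upClosed i u wᵢ≢0 wᵢ<u u≤n with k , k<j , wᵢ≡n∸k ← ∈-applyUpTo⁻ (n ∸_) (values i wᵢ≢0) =
        occurs u (∈-topValues u≤n (<-trans n∸u<n∸wᵢ (subst (_< j) (sym n∸wᵢ≡k) k<j)))
        where
        n∸wᵢ≡k : n ∸ lookup w i ≡ k
        n∸wᵢ≡k = trans (cong (n ∸_) wᵢ≡n∸k) (m∸[m∸n]≡n (≤-trans (<⇒≤ k<j) j≤n))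
        n∸u<n∸wᵢ : n ∸ u < n ∸ lookup w i
        n∸u<n∸wᵢ = ∸-monoʳ-< wᵢ<u u≤n

    topArrangement-≤ : ∀ {j′} → j′ ≤ n → IsArrangement (topValues n j) w → IsArrangement (topValues n j′) w →
                       j′ ≤ j
    topArrangement-≤ {j′} j′≤n (mkArrangement values _ _) (mkArrangement _ occurs′ _) = ≮⇒≥ λ j<j′ →
      let p , wₚ≡n∸j = occurs′ (n ∸ j) (∈-applyUpTo⁺ (n ∸_) j<j′)
          n∸j≢0 = m>n⇒m∸n≢0 (<-≤-trans j<j′ j′≤n)
          k , k<j , wₚ≡n∸k = ∈-applyUpTo⁻ (n ∸_) (values p (λ wₚ≡0 → n∸j≢0 (trans (sym wₚ≡n∸j) wₚ≡0)))
      in <⇒≢ (∸-monoʳ-< k<j (≤-trans (<⇒≤ j<j′) j′≤n)) (trans (sym wₚ≡n∸j) wₚ≡n∸k)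

  topArrangement-injective : ∀ {m n j j′} {w : Vec ℕ m} → j ≤ n → j′ ≤ n →
                             IsArrangement (topValues n j) w → IsArrangement (topValues n j′) w → j ≡ j′
  topArrangement-injective {m} {n} {j} {j′} {w} j≤n j′≤n arrangement arrangement′ =
    ≤-antisym (topArrangement-≤ {m} {n} {j′} {w} j≤n arrangement′ arrangement)
              (topArrangement-≤ {m} {n} {j} {w} j′≤n arrangement arrangement′)

  upClosedWord⇒topArrangement : ∀ {m n} {w : Vec ℕ m} → IsUpClosedWord m n w →
                                ∃ λ j → j ≤ n × IsArrangement (topValues n j) w
  upClosedWord⇒topArrangement {m} {n} {w} ((bounded , distinct) , upClosed)
    with j , j≤n , prefix , stop ← longest-prefix (λ k → Fin.any? (λ i → lookup w i ≟ n ∸ k)) n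
    = j , j≤n , mkArrangement values occurs distinct
    where
    Present : ℕ → Set
    Present v = ∃ λ i → lookup w i ≡ v

    values : ∀ i → lookup w i ≢ 0 → lookup w i ∈ topValues n j
    values i wᵢ≢0 = ∈-topValues (bounded i) (≰⇒> λ j≤n∸wᵢ →
      notBelow (subst (_≤ n ∸ j) (m∸[m∸n]≡n (bounded i)) (∸-monoʳ-≤ n j≤n∸wᵢ)) stop)
      where
      notBelow : lookup w i ≤ n ∸ j → j ≡ n ⊎ ¬ Present (n ∸ j) → ⊥
      notBelow wᵢ≤n∸j (inj₁ refl) = wᵢ≢0 (n≤0⇒n≡0 (subst (lookup w i ≤_) (n∸n≡0 n) wᵢ≤n∸j))
      notBelow wᵢ≤n∸j (inj₂ absent) with m≤n⇒m<n∨m≡n wᵢ≤n∸j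
      ... | inj₁ wᵢ<n∸j = absent (upClosed i (n ∸ j) wᵢ≢0 wᵢ<n∸j (m∸n≤m n j))
      ... | inj₂ wᵢ≡n∸j = absent (i , wᵢ≡n∸j)

    occurs : ∀ v → v ∈ topValues n j → Present v
    occurs v v∈ with k , k<j , refl ← ∈-applyUpTo⁻ (n ∸_) v∈ = prefix k k<j

module VertexList where
  open import Data.Nat using (_+_; _∸_; s≤s; s≤s⁻¹)
  open import Data.Nat.Properties
  open import Data.Nat.ListAction using (sum)
  open import Data.Vec using (map)
  open import Data.List as List using (concatMap; applyUpTo)
  open import Data.List.Properties using (length-map; length-applyUpTo; map-cong-local; map-applyUpTo)
  open import Data.List.Membership.Propositional using (find; lose)
  open import Data.List.Membership.Propositional.Properties
    using (∈-map⁺; ∈-map⁻; ∈-concatMap⁺; ∈-concatMap⁻; ∈-applyUpTo⁺; ∈-applyUpTo⁻)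
  import Data.List.Relation.Unary.All as All
  import Data.List.Relation.Unary.Unique.Propositional.Properties as Unique
  open import Data.Product using (proj₁)
  open import Function using (_∘_)
  open import Function.Bundles using (mk⇔)
  open import Relation.Binary.PropositionalEquality using (refl; sym; trans; cong; subst; module ≡-Reasoning)
  open Vertices using (vertex⇔upClosedWord; map-toℚ-injective)
  open Arrangements

  -- The possible numbers k of zero entries of a vertex, max(m - n, 0) ≤ k ≤ m: the summation
  -- range of vertexCount.
  zeroCounts : ℕ → ℕ → List ℕ
  zeroCounts m n = applyUpTo (m ∸ n +_) (suc m ∸ (m ∸ n))

  verticesWithZeros : (m n k : ℕ) → List (Point m)
  verticesWithZeros m n k = List.map (map toℚ) (arrangements m (topValues n (m ∸ k)))

  vertexList : (m n : ℕ) → List (Point m)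
  vertexList m n = concatMap (verticesWithZeros m n) (zeroCounts m n)

  module _ (m n : ℕ) where
    ∈-zeroCounts⁻ : ∀ {k} → k ∈ zeroCounts m n → m ∸ n ≤ k × k ≤ m
    ∈-zeroCounts⁻ k∈ with i , i<N , refl ← ∈-applyUpTo⁻ (m ∸ n +_) k∈ =
      m≤m+n (m ∸ n) i ,
      s≤s⁻¹ (subst (m ∸ n + i <_) (m+[n∸m]≡n (≤-trans (m∸n≤m m n) (n≤1+n m))) (+-monoʳ-< (m ∸ n) i<N))

    ∈-zeroCounts⁺ : ∀ {k} → m ∸ n ≤ k → k ≤ m → k ∈ zeroCounts m n
    ∈-zeroCounts⁺ m∸n≤k k≤m =
      subst (_∈ zeroCounts m n) (m+[n∸m]≡n m∸n≤k) (∈-applyUpTo⁺ (m ∸ n +_) (∸-monoˡ-< (s≤s k≤m) m∸n≤k))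

    nonzeroCount-≤ : ∀ {k} → m ∸ n ≤ k → m ∸ k ≤ n
    nonzeroCount-≤ {k} m∸n≤k =
      m≤n+o⇒m∸n≤o m k (subst (m ≤_) (+-comm n k) (≤-trans (m≤n+m∸n m n) (+-monoʳ-≤ n m∸n≤k)))

    length-vertexList : length (vertexList m n) ≡ vertexCount m n
    length-vertexList = begin
      length (concatMap (verticesWithZeros m n) (zeroCounts m n))
        ≡⟨ length-concatMap (verticesWithZeros m n) (zeroCounts m n) ⟩
      sum (List.map (length ∘ verticesWithZeros m n) (zeroCounts m n))
        ≡⟨ cong sum (map-cong-local (All.tabulate (blockLength ∘ ∈-zeroCounts⁻))) ⟩
      sum (List.map (factQuot m) (zeroCounts m n))
        ≡⟨ cong sum (map-applyUpTo (m ∸ n +_) (factQuot m) (suc m ∸ (m ∸ n))) ⟩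
      vertexCount m n
        ∎
      where
      open ≡-Reasoning
      blockLength : ∀ {k} → m ∸ n ≤ k × k ≤ m → length (verticesWithZeros m n k) ≡ factQuot m k
      blockLength {k} (m∸n≤k , k≤m) = begin
        length (verticesWithZeros m n k)
          ≡⟨ length-map (map toℚ) (arrangements m (topValues n (m ∸ k))) ⟩
        length (arrangements m (topValues n (m ∸ k)))
          ≡⟨ length-arrangements m (topValues-unique (nonzeroCount-≤ m∸n≤k)) ⟩
        fallingFactorial m (length (topValues n (m ∸ k)))
          ≡⟨ cong (fallingFactorial m) (length-applyUpTo (n ∸_) (m ∸ k)) ⟩
        fallingFactorial m (m ∸ k)
          ≡⟨ factQuot≡fallingFactorial k≤m ⟨
        factQuot m k
          ∎

    vertexList-unique : Unique (vertexList m n)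
    vertexList-unique =
      concatMap-unique (verticesWithZeros m n) zeroCounts-unique (blockUnique ∘ ∈-zeroCounts⁻) determined
      where
      zeroCounts-unique : Unique (zeroCounts m n)
      zeroCounts-unique =
        Unique.applyUpTo⁺₁ (m ∸ n +_) (suc m ∸ (m ∸ n)) λ i<j _ → <⇒≢ (+-monoʳ-< (m ∸ n) i<j)
      blockUnique : ∀ {k} → m ∸ n ≤ k × k ≤ m → Unique (verticesWithZeros m n k)
      blockUnique (m∸n≤k , _) = Unique.map⁺ map-toℚ-injective
        (arrangements-unique m (topValues-unique (nonzeroCount-≤ m∸n≤k)) (0∉topValues (nonzeroCount-≤ m∸n≤k)))
      determined : ∀ {k k′ x} → k ∈ zeroCounts m n → k′ ∈ zeroCounts m n →
                   x ∈ verticesWithZeros m n k → x ∈ verticesWithZeros m n k′ → k ≡ k′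
      determined {k} {k′} k∈ k′∈ x∈ x∈′
        with w , w∈ , refl ← ∈-map⁻ (map toℚ) x∈
           | w′ , w′∈ , eq ← ∈-map⁻ (map toℚ) x∈′
        with refl ← map-toℚ-injective eq
        with m∸n≤k , k≤m ← ∈-zeroCounts⁻ k∈
           | m∸n≤k′ , k′≤m ← ∈-zeroCounts⁻ k′∈
        = ∸-cancelˡ-≡ k≤m k′≤m (topArrangement-injective (nonzeroCount-≤ m∸n≤k) (nonzeroCount-≤ m∸n≤k′)
                                  (arrangements-sound m _ w∈) (arrangements-sound m _ w′∈))

    upClosedWord⇔∈vertexList : ∀ x → (∃ λ w → IsUpClosedWord m n w × x ≡ map toℚ w) ⇔ x ∈ vertexList m n
    upClosedWord⇔∈vertexList x = mk⇔ to from
      where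
      to : (∃ λ w → IsUpClosedWord m n w × x ≡ map toℚ w) → x ∈ vertexList m n
      to (w , (isWord , upClosed) , refl)
        with j , j≤n , arrangement ← upClosedWord⇒topArrangement {w = w} (isWord , upClosed)
        = ∈-concatMap⁺ (verticesWithZeros m n) (lose k∈ (∈-map⁺ (map toℚ) w∈))
        where
        j≤m : j ≤ m
        j≤m = subst (_≤ m) (length-applyUpTo (n ∸_) j)
                    (arrangement-length-≤ (topValues-unique j≤n) (0∉topValues j≤n) arrangement)
        k∈ : m ∸ j ∈ zeroCounts m n
        k∈ = ∈-zeroCounts⁺ (∸-monoʳ-≤ m j≤n) (m∸n≤m m j)
        w∈ : w ∈ arrangements m (topValues n (m ∸ (m ∸ j)))
        w∈ = subst (λ t → w ∈ arrangements m (topValues n t)) (sym (m∸[m∸n]≡n j≤m))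
                   (arrangements-complete m (topValues n j) (0∉topValues j≤n) arrangement)
      from : x ∈ vertexList m n → ∃ λ w → IsUpClosedWord m n w × x ≡ map toℚ w
      from x∈ with k , k∈ , x∈block ← find (∈-concatMap⁻ (verticesWithZeros m n) {xs = zeroCounts m n} x∈)
              with w , w∈ , refl ← ∈-map⁻ (map toℚ) x∈block
        = w , topArrangement⇒upClosedWord (nonzeroCount-≤ (proj₁ (∈-zeroCounts⁻ k∈))) (arrangements-sound m _ w∈)
            , refl

open Vertices using (vertex⇔upClosedWord)
open VertexList using (vertexList; vertexList-unique; length-vertexList; upClosedWord⇔∈vertexList)

proposition5p6 : (m n : ℕ) → 1 ≤ m → 1 ≤ n →
    Σ (List (Point m)) (λ V →
      Unique V × length V ≡ vertexCount m n × (∀ x → IsVertex m n x ⇔ x ∈ V))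
proposition5p6 m n _ _ =
  vertexList m n , vertexList-unique m n , length-vertexList m n ,
  λ x → ⇔.trans (vertex⇔upClosedWord x) (upClosedWord⇔∈vertexList m n x)
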